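{- Let $\epsilon\in[0,1)$ and let $G=(V,E)$ be a finite simple graph with $\epsilon|V|$ an integer and $(1+\epsilon)\tfrac{|V|}{2}$ an integer. Then $\textsc{GEB}_\epsilon(\mathcal{K}(G)) \leq \textsc{GB}_\epsilon(G)$.
   Context: For a graph $H=(V_H,E_H)$, $\textsc{GB}_\epsilon(H)$ is the minimum, over all partitions $V_H=V_1\cup V_2$ into disjoint sets with $|V_i|\le(1+\epsilon)\tfrac{|V_H|}{2}$, of the number of edges $\{u,v\}\in E_H$ with $u\in V_1$, $v\in V_2$. $\textsc{GEB}_\epsilon(H)$ is the minimum, over all partitions $E_H=E_1\cup E_2$ into disjoint sets with $|E_i|\le(1+\epsilon)\tfrac{|E_H|}{2}$, of the number of vertices incident to at least one edge of $E_1$ and at least one edge of $E_2$ ("cut" vertices). Clique expansion: given $G=(V,E)$, let $S=4+2|V|\binom{|E|}{2}$. $\mathcal{K}(G)$ is obtained by taking a disjoint union of $|V|$ copies $K_u$ ($u\in V$) of the complete graph $K_S$, each with vertices numbered $1,\dots,S$; then, labelling the edges of $E$ as $e_1,\dots,e_{|E|}$, for each $e_i=\{u,v\}$ the $i$-th vertex of $K_u$ is identified (merged) with the $i$-th vertex of $K_v$. -}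

module Defs where

open import Data.Nat using (ℕ; zero; suc; _+_; _*_; _≤_; _<_; _<?_)
open import Data.Nat.Combinatorics using (_C_)
open import Data.Bool using (Bool; true; false; not; _∧_; _∨_; if_then_else_)
open import Data.Fin using (Fin; toℕ; fromℕ<) renaming (_≟_ to _≟F_)
import Data.Fin as F
open import Data.List using (List; []; _∷_; length; allFin; concatMap; filterᵇ; lookup; map)
open import Data.Product using (_×_; _,_; proj₁; proj₂; ∃; Σ)
open import Data.Product.Properties using (≡-dec)
open import Data.Sum using (_⊎_)
open import Relation.Nullary using (¬_; yes; no)
open import Relation.Nullary.Decidable using (⌊_⌋)
open import Relation.Binary.Definitions using (DecidableEquality)
open import Relation.Binary.PropositionalEquality using (_≡_; _≢_)

countF : (k : ℕ) → (Fin k → Bool) → ℕ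
countF zero    f = 0
countF (suc k) f = (if f F.zero then 1 else 0) + countF k (λ i → f (F.suc i))

anyF : (k : ℕ) → (Fin k → Bool) → Bool
anyF zero    f = false
anyF (suc k) f = f F.zero ∨ anyF k (λ i → f (F.suc i))

countL : {A : Set} → (A → Bool) → List A → ℕ
countL p xs = length (filterᵇ p xs)

xor : Bool → Bool → Bool
xor true  b = not b
xor false b = b

-- Finite simple graphs with vertex set Fin n and edges e_0 … e_{m-1}
-- (the list index gives the edge labelling used by the clique expansion).

SameEdge : {n : ℕ} → Fin n × Fin n → Fin n × Fin n → Set
SameEdge (a , b) (c , d) = (a ≡ c × b ≡ d) ⊎ (a ≡ d × b ≡ c)

record Graph : Set where
  field
    n        : ℕ
    m        : ℕ
    edge     : Fin m → Fin n × Fin n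
    loopless : ∀ i → proj₁ (edge i) ≢ proj₂ (edge i)
    simple   : ∀ i j → SameEdge (edge i) (edge j) → i ≡ j
open Graph public

-- ε = p / q with 0 ≤ p < q; "|X| ≤ (1+ε) T / 2" is  2 q |X| ≤ (q + p) T.
BalancedSize : (p q T s : ℕ) → Set
BalancedSize p q T s = 2 * q * s ≤ (q + p) * T

-- Vertex bipartitions: c v = true means v ∈ V₁, false means v ∈ V₂.
VBalanced : (p q : ℕ) (G : Graph) → (Fin (n G) → Bool) → Set
VBalanced p q G c =
  BalancedSize p q (n G) (countF (n G) c) ×
  BalancedSize p q (n G) (countF (n G) (λ v → not (c v)))

edgeCut : (G : Graph) → (Fin (n G) → Bool) → ℕ
edgeCut G c = countF (m G) (λ i → xor (c (proj₁ (edge G i))) (c (proj₂ (edge G i))))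

IsGB : (p q : ℕ) → Graph → ℕ → Set
IsGB p q G b =
  (Σ (Fin (n G) → Bool) λ c → VBalanced p q G c × edgeCut G c ≡ b) ×
  (∀ c → VBalanced p q G c → b ≤ edgeCut G c)

record FinGraph : Set₁ where
  field
    V     : Set
    decV  : DecidableEquality V
    verts : List V            -- the vertex set (without repetitions)
    edges : List (V × V)      -- the edge set (without repetitions)
open FinGraph public

numE : FinGraph → ℕ
numE H = length (edges H)

-- Edge bipartitions: c e = true means e ∈ E₁, false means e ∈ E₂.
EBalanced : (p q : ℕ) (H : FinGraph) → (Fin (numE H) → Bool) → Set
EBalanced p q H c =
  BalancedSize p q (numE H) (countF (numE H) c) ×
  BalancedSize p q (numE H) (countF (numE H) (λ e → not (c e)))

incident : (H : FinGraph) → V H → Fin (numE H) → Bool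
incident H v e = ⌊ decV H v (proj₁ (lookup (edges H) e)) ⌋ ∨ ⌊ decV H v (proj₂ (lookup (edges H) e)) ⌋

isCutVertex : (H : FinGraph) → (Fin (numE H) → Bool) → V H → Bool
isCutVertex H c v =
  anyF (numE H) (λ e → incident H v e ∧ c e) ∧
  anyF (numE H) (λ e → incident H v e ∧ not (c e))

cutVertices : (H : FinGraph) → (Fin (numE H) → Bool) → ℕ
cutVertices H c = countL (isCutVertex H c) (verts H)

IsGEB : (p q : ℕ) → FinGraph → ℕ → Set
IsGEB p q H a =
  (Σ (Fin (numE H) → Bool) λ c → EBalanced p q H c × cutVertices H c ≡ a) ×
  (∀ c → EBalanced p q H c → a ≤ cutVertices H c)

-- Before merging, the vertices are pairs (u , j): the j-th vertex of K_u.
-- For j < m with e_j = {a , b}, the vertices (a , j) and (b , j) are merged;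
-- the merged vertex is represented by (proj₁ (edge j) , j).

cliqueSize : Graph → ℕ
cliqueSize G = 4 + 2 * n G * (m G C 2)

PreV : Graph → Set
PreV G = Fin (n G) × Fin (cliqueSize G)

canon : (G : Graph) → PreV G → PreV G
canon G (u , j) with toℕ j <? m G
... | no _  = (u , j)
... | yes j<m with edge G (fromℕ< j<m)
...   | (a , b) =
  if ⌊ u ≟F a ⌋ ∨ ⌊ u ≟F b ⌋ then (a , j) else (u , j)

decPreV : (G : Graph) → DecidableEquality (PreV G)
decPreV G = ≡-dec _≟F_ _≟F_

allPre : (G : Graph) → List (PreV G)
allPre G = concatMap (λ u → map (λ j → (u , j)) (allFin (cliqueSize G))) (allFin (n G))

cliqueEdges : (G : Graph) → List (PreV G × PreV G)
cliqueEdges G =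
  concatMap (λ u →
    concatMap (λ j →
      map (λ j' → (canon G (u , j) , canon G (u , j')))
          (filterᵇ (λ j' → ⌊ toℕ j <? toℕ j' ⌋) (allFin (cliqueSize G))))
      (allFin (cliqueSize G)))
    (allFin (n G))

K : Graph → FinGraph
K G = record
  { V     = PreV G
  ; decV  = decPreV G
  ; verts = filterᵇ (λ x → ⌊ decPreV G (canon G x) x ⌋) (allPre G)
  ; edges = cliqueEdges G
  }

-- Colour each edge of K(G) by the side, in an optimal balanced vertex partition of G, of
-- the clique K_u it comes from. All cliques have the same number of edges, so this edge
-- partition is balanced whenever the vertex partition is. A vertex of K(G) meeting edges
-- of both colours lies in two cliques of different colours, so it is the merged vertex
-- (a_k , k) of a cut edge e_k = {a_k , b_k} of G; distinct such vertices have distinct k.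
module Submission where

open import Defs
open import Data.Nat using (ℕ; _+_; _*_; _≤_; _<_)
open import Data.Nat.Divisibility using (_∣_)

open import Data.Nat using (zero; suc; z≤n; s≤s; _<?_)
open import Data.Nat.Properties
  using (+-mono-≤; +-monoʳ-≤; ≤-refl; ≤-trans; ≤-reflexive; m≤n+m; n≤0⇒n≡0; *-assoc; *-monoˡ-≤; *-distribʳ-+; +-*-semiring; module ≤-Reasoning)
open import Data.Bool using (Bool; true; false; not; _∧_; if_then_else_; T)
open import Data.Bool.Properties using (T-∧; T-∨)
open import Data.Fin using (Fin; toℕ; fromℕ<) renaming (_≟_ to _≟F_)
import Data.Fin as F
open import Data.List using (List; []; _∷_; length; allFin; concatMap; filterᵇ; lookup; map; tabulate; _++_)
open import Data.List.Properties using (length-++; length-map; filter-++; map-concatMap; concatMap-cong; map-∘; map-id)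
open import Data.List.Membership.Propositional using (_∈_)
open import Data.List.Membership.Propositional.Properties using (∈-concatMap⁻; ∈-map⁻)
open import Data.List.Relation.Unary.Any using (here; there; satisfied)
open import Data.Product using (_×_; _,_; proj₁; proj₂; Σ; ∃; ∃₂)
open import Data.Sum using (_⊎_; inj₁; inj₂; [_,_])
import Data.Sum as Sum
open import Data.Empty using (⊥-elim)
open import Function using (_∘_; Equivalence)
open import Relation.Nullary using (¬_; yes; no)
open import Relation.Nullary.Decidable using (⌊_⌋; ⌊⌋-map′; toWitness; fromWitness)
open import Relation.Binary.PropositionalEquality using (_≡_; _≢_; refl; sym; trans; cong; cong₂; subst; subst₂; module ≡-Reasoning)
open import Algebra.Properties.Semiring.Sum +-*-semiring
  using (sum; sum-syntax; ∑-comm; sum-cong-≗; sum-replicate-zero)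

open Equivalence using (to; from)

indicator : Bool → ℕ
indicator b = if b then 1 else 0

indicator-mono : ∀ {b b′} → (T b → T b′) → indicator b ≤ indicator b′
indicator-mono {false} _ = z≤n
indicator-mono {true} {true}  _ = ≤-refl
indicator-mono {true} {false} h = ⊥-elim (h _)

T-not-¬ : ∀ {b} → T b → ¬ T (not b)
T-not-¬ {true} _ ()

xor-true : ∀ {x y} → T x → T (not y) → T (xor x y) × T (xor y x)
xor-true {true} {false} _ _ = _ , _

countF≡∑ : ∀ k (f : Fin k → Bool) → countF k f ≡ ∑[ i < k ] indicator (f i)
countF≡∑ zero    f = refl
countF≡∑ (suc k) f = cong (indicator (f F.zero) +_) (countF≡∑ k (f ∘ F.suc))

countF-true : ∀ k → countF k (λ _ → true) ≡ k
countF-true zero    = refl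
countF-true (suc k) = cong suc (countF-true k)

∑-mono-≤ : ∀ {k} {f g : Fin k → ℕ} → (∀ i → f i ≤ g i) → sum f ≤ sum g
∑-mono-≤ {zero}  _ = z≤n
∑-mono-≤ {suc k} f≤g = +-mono-≤ (f≤g F.zero) (∑-mono-≤ (f≤g ∘ F.suc))

∑-indicator-≟ : ∀ {k} (a : Fin k) → ∑[ i < k ] indicator ⌊ i ≟F a ⌋ ≡ 1
∑-indicator-≟ {suc k} F.zero    = cong suc (sum-replicate-zero k)
∑-indicator-≟ {suc k} (F.suc a) =
  trans (sum-cong-≗ (λ i → cong indicator (⌊⌋-map′ _ _ (i ≟F a)))) (∑-indicator-≟ a)

∑-indicator-∧-≟ : ∀ {k} b (a : Fin k) → ∑[ i < k ] indicator (b ∧ ⌊ i ≟F a ⌋) ≡ indicator b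
∑-indicator-∧-≟ {k} false a = sum-replicate-zero k
∑-indicator-∧-≟     true  a = ∑-indicator-≟ a

∑-≤-countF : ∀ {s m} (h : Fin s → ℕ) (g : Fin m → Bool) →
             (∀ k → ¬ toℕ k < m → h k ≡ 0) →
             (∀ k (k<m : toℕ k < m) → h k ≤ indicator (g (fromℕ< k<m))) →
             sum h ≤ countF m g
∑-≤-countF {zero}            h g _      _      = z≤n
∑-≤-countF {suc s} {zero}    h g h≥m≡0 _      rewrite h≥m≡0 F.zero (λ ()) =
  ∑-≤-countF (h ∘ F.suc) g (λ k _ → h≥m≡0 (F.suc k) (λ ())) (λ _ ())
∑-≤-countF {suc s} {suc m}   h g h≥m≡0 h<m≤g =
  +-mono-≤ (h<m≤g F.zero (s≤s z≤n))
           (∑-≤-countF (h ∘ F.suc) (g ∘ F.suc)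
             (λ k k≮m → h≥m≡0 (F.suc k) (λ { (s≤s k<m) → k≮m k<m }))
             (λ k k<m → h<m≤g (F.suc k) (s≤s k<m)))

anyF-sound : ∀ k (f : Fin k → Bool) → T (anyF k f) → ∃ λ i → T (f i)
anyF-sound (suc k) f any with f F.zero in eq
... | true  = F.zero , subst T (sym eq) _
... | false = let i , fi = anyF-sound k (f ∘ F.suc) any in F.suc i , fi

module _ {A : Set} where

  countL-∷ : ∀ (P : A → Bool) x xs → countL P (x ∷ xs) ≡ indicator (P x) + countL P xs
  countL-∷ P x xs with P x
  ... | true  = refl
  ... | false = refl

  countL-++ : ∀ (P : A → Bool) xs ys → countL P (xs ++ ys) ≡ countL P xs + countL P ys
  countL-++ P xs ys = trans (cong length (filter-++ _ xs ys)) (length-++ (filterᵇ P xs))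

  countL-const : ∀ b (xs : List A) → countL (λ _ → b) xs ≡ indicator b * length xs
  countL-const true  []       = refl
  countL-const true  (x ∷ xs) = cong suc (countL-const true xs)
  countL-const false []       = refl
  countL-const false (x ∷ xs) = countL-const false xs

  countL-tabulate : ∀ (P : A → Bool) {k} (g : Fin k → A) → countL P (tabulate g) ≡ countF k (P ∘ g)
  countL-tabulate P {zero}  g = refl
  countL-tabulate P {suc k} g =
    trans (countL-∷ P (g F.zero) _) (cong (indicator (P (g F.zero)) +_) (countL-tabulate P (g ∘ F.suc)))

  countL-filterᵇ-≤ : ∀ (P Q : A → Bool) xs → countL P (filterᵇ Q xs) ≤ countL P xs
  countL-filterᵇ-≤ P Q []       = z≤n
  countL-filterᵇ-≤ P Q (x ∷ xs) with Q x
  ... | true  rewrite countL-∷ P x (filterᵇ Q xs) | countL-∷ P x xs =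
    +-monoʳ-≤ (indicator (P x)) (countL-filterᵇ-≤ P Q xs)
  ... | false rewrite countL-∷ P x xs = ≤-trans (countL-filterᵇ-≤ P Q xs) (m≤n+m _ (indicator (P x)))

module _ {A B : Set} where

  countL-map : ∀ (P : B → Bool) (f : A → B) xs → countL P (map f xs) ≡ countL (P ∘ f) xs
  countL-map P f []       = refl
  countL-map P f (x ∷ xs) = trans (countL-∷ P (f x) (map f xs))
    (trans (cong (indicator (P (f x)) +_) (countL-map P f xs)) (sym (countL-∷ (P ∘ f) x xs)))

  countL-concatMap-tabulate : ∀ (P : B → Bool) (f : A → List B) {k} (g : Fin k → A) →
    countL P (concatMap f (tabulate g)) ≡ ∑[ i < k ] countL P (f (g i))
  countL-concatMap-tabulate P f {zero}  g = refl
  countL-concatMap-tabulate P f {suc k} g =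
    trans (countL-++ P (f (g F.zero)) _) (cong (countL P (f (g F.zero)) +_) (countL-concatMap-tabulate P f (g ∘ F.suc)))

  length-concatMap-map : ∀ {C : Set} (h : A → B → C) (F : A → List B) xs →
    length (concatMap (λ x → map (h x) (F x)) xs) ≡ length (concatMap F xs)
  length-concatMap-map h F []       = refl
  length-concatMap-map h F (x ∷ xs) = begin
    length (map (h x) (F x) ++ concatMap (λ x → map (h x) (F x)) xs)
      ≡⟨ length-++ (map (h x) (F x)) ⟩
    length (map (h x) (F x)) + length (concatMap (λ x → map (h x) (F x)) xs)
      ≡⟨ cong₂ _+_ (length-map (h x) (F x)) (length-concatMap-map h F xs) ⟩
    length (F x) + length (concatMap F xs)
      ≡⟨ length-++ (F x) ⟨
    length (F x ++ concatMap F xs) ∎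
    where open ≡-Reasoning

module _ {A B : Set} where

  Tagged : (A → List B) → List A → List (A × B)
  Tagged blocks = concatMap (λ a → map (a ,_) (blocks a))

  map-proj₂-Tagged : ∀ (blocks : A → List B) xs → map proj₂ (Tagged blocks xs) ≡ concatMap blocks xs
  map-proj₂-Tagged blocks xs =
    trans (map-concatMap proj₂ _ xs) (concatMap-cong (λ a → trans (sym (map-∘ (blocks a))) (map-id (blocks a))) xs)

  ∈-Tagged⁻ : ∀ {blocks : A → List B} {xs a b} → (a , b) ∈ Tagged blocks xs → b ∈ blocks a
  ∈-Tagged⁻ {blocks} {xs} ab∈ with satisfied (∈-concatMap⁻ (λ a → map (a ,_) (blocks a)) {xs = xs} ab∈)
  ... | _ , ab∈′ with ∈-map⁻ (_ ,_) ab∈′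
  ... | _ , b∈ , refl = b∈

  countL-Tagged : ∀ (P : A → Bool) {blocks : A → List B} {ℓ} → (∀ a → length (blocks a) ≡ ℓ) →
                  ∀ xs → countL (P ∘ proj₁) (Tagged blocks xs) ≡ countL P xs * ℓ
  countL-Tagged P {blocks} {ℓ} ∣blocks∣ [] = refl
  countL-Tagged P {blocks} {ℓ} ∣blocks∣ (x ∷ xs) = begin
    countL (P ∘ proj₁) (map (x ,_) (blocks x) ++ Tagged blocks xs)
      ≡⟨ countL-++ (P ∘ proj₁) (map (x ,_) (blocks x)) _ ⟩
    countL (P ∘ proj₁) (map (x ,_) (blocks x)) + countL (P ∘ proj₁) (Tagged blocks xs)
      ≡⟨ cong₂ _+_ (countL-map (P ∘ proj₁) (x ,_) (blocks x)) (countL-Tagged P ∣blocks∣ xs) ⟩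
    countL (λ _ → P x) (blocks x) + countL P xs * ℓ
      ≡⟨ cong (_+ countL P xs * ℓ) (trans (countL-const (P x) (blocks x)) (cong (indicator (P x) *_) (∣blocks∣ x))) ⟩
    indicator (P x) * ℓ + countL P xs * ℓ
      ≡⟨ *-distribʳ-+ ℓ (indicator (P x)) (countL P xs) ⟨
    (indicator (P x) + countL P xs) * ℓ
      ≡⟨ cong (_* ℓ) (countL-∷ P x xs) ⟨
    countL P (x ∷ xs) * ℓ ∎
    where open ≡-Reasoning

  tagAt : (T : List (A × B)) {L : List B} → map proj₂ T ≡ L → Fin (length L) → A
  tagAt ((a , _) ∷ T) refl F.zero    = a
  tagAt (_       ∷ T) refl (F.suc e) = tagAt T refl e

  countF-tagAt : ∀ (T : List (A × B)) {L} (eq : map proj₂ T ≡ L) (P : A → Bool) →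
                 countF (length L) (P ∘ tagAt T eq) ≡ countL (P ∘ proj₁) T
  countF-tagAt []       refl P = refl
  countF-tagAt (x ∷ T) refl P =
    trans (cong (indicator (P (proj₁ x)) +_) (countF-tagAt T refl P)) (sym (countL-∷ (P ∘ proj₁) x T))

  tagAt-∈ : ∀ (T : List (A × B)) {L} (eq : map proj₂ T ≡ L) e → (tagAt T eq e , lookup L e) ∈ T
  tagAt-∈ (x ∷ T) refl F.zero    = here refl
  tagAt-∈ (x ∷ T) refl (F.suc e) = there (tagAt-∈ T refl e)

BalancedSize-* : ∀ {p q t s} ℓ → BalancedSize p q t s → BalancedSize p q (t * ℓ) (s * ℓ)
BalancedSize-* {p} {q} {t} {s} ℓ bal = begin
  2 * q * (s * ℓ)   ≡⟨ *-assoc (2 * q) s ℓ ⟨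
  2 * q * s * ℓ     ≤⟨ *-monoˡ-≤ ℓ bal ⟩
  (q + p) * t * ℓ   ≡⟨ *-assoc (q + p) t ℓ ⟩
  (q + p) * (t * ℓ) ∎
  where open ≤-Reasoning

incident⇒endpoint : ∀ H v e → T (incident H v e) →
  v ≡ proj₁ (lookup (edges H) e) ⊎ v ≡ proj₂ (lookup (edges H) e)
incident⇒endpoint H v e inc = Sum.map toWitness toWitness (T-∨ {⌊ decV H v (proj₁ (lookup (edges H) e)) ⌋} .to inc)

isCutVertex⇒witnesses : ∀ H col v → T (isCutVertex H col v) →
  ∃₂ λ e₁ e₂ → T (incident H v e₁) × T (col e₁) × T (incident H v e₂) × T (not (col e₂))
isCutVertex⇒witnesses H col v isCut =
  let some₁ , some₂ = T-∧ .to isCut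
      e₁ , inc∧c₁ = anyF-sound _ _ some₁
      e₂ , inc∧¬c₂ = anyF-sound _ _ some₂
      inc₁ , c₁ = T-∧ .to inc∧c₁
      inc₂ , ¬c₂ = T-∧ .to inc∧¬c₂
  in e₁ , e₂ , inc₁ , c₁ , inc₂ , ¬c₂

Endpoint : ∀ {k} → Fin k → Fin k × Fin k → Set
Endpoint u (a , b) = u ≡ a ⊎ u ≡ b

module CliqueExpansion (G : Graph) where

  data CanonView (u : Fin (n G)) (k : Fin (cliqueSize G)) : PreV G → Set where
    merged   : (k<m : toℕ k < m G) → Endpoint u (edge G (fromℕ< k<m)) →
               CanonView u k (proj₁ (edge G (fromℕ< k<m)) , k)
    unmerged : (∀ (k<m : toℕ k < m G) → ¬ Endpoint u (edge G (fromℕ< k<m))) →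
               CanonView u k (u , k)

  private
    mergedAt : ∀ {u k e} (k<m : toℕ k < m G) → edge G (fromℕ< k<m) ≡ e → Endpoint u e →
               CanonView u k (proj₁ e , k)
    mergedAt k<m refl = merged k<m

  canonView : ∀ u k → CanonView u k (canon G (u , k))
  canonView u k with toℕ k <? m G
  ... | no k≮m = unmerged (λ k<m _ → k≮m k<m)
  ... | yes k<m with edge G (fromℕ< k<m) in eq
  ...   | (a , b) with u ≟F a | u ≟F b
  ...     | yes u≡a | _       = mergedAt k<m eq (inj₁ u≡a)
  ...     | no _    | yes u≡b = mergedAt k<m eq (inj₂ u≡b)
  ...     | no u≢a  | no u≢b  = unmerged (λ _ → subst (λ e → ¬ Endpoint u e) (sym eq) [ u≢a , u≢b ])

  canonView-snd : ∀ {u k r} → CanonView u k r → proj₂ r ≡ k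
  canonView-snd (merged _ _) = refl
  canonView-snd (unmerged _) = refl

  canon-snd : ∀ u k → proj₂ (canon G (u , k)) ≡ k
  canon-snd u k = canonView-snd (canonView u k)

  canon-at-snd : ∀ {u j v} → v ≡ canon G (u , j) → canon G (u , proj₂ v) ≡ v
  canon-at-snd {u} {j} refl = cong (λ k → canon G (u , k)) (canon-snd u j)

  canon-merge : ∀ {u₁ u₂} k → canon G (u₁ , k) ≡ canon G (u₂ , k) → u₁ ≢ u₂ →
    Σ (toℕ k < m G) λ k<m →
      Endpoint u₁ (edge G (fromℕ< k<m)) × Endpoint u₂ (edge G (fromℕ< k<m)) ×
      proj₁ (canon G (u₁ , k)) ≡ proj₁ (edge G (fromℕ< k<m))
  canon-merge {u₁} {u₂} k = views-merge (canonView u₁ k) (canonView u₂ k)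
    where
    views-merge : ∀ {r₁ r₂} → CanonView u₁ k r₁ → CanonView u₂ k r₂ → r₁ ≡ r₂ → u₁ ≢ u₂ →
      Σ (toℕ k < m G) λ k<m →
        Endpoint u₁ (edge G (fromℕ< k<m)) × Endpoint u₂ (edge G (fromℕ< k<m)) ×
        proj₁ r₁ ≡ proj₁ (edge G (fromℕ< k<m))
    views-merge (merged k<m end₁) (merged _ end₂) _  _     = k<m , end₁ , end₂ , refl
    views-merge (merged k<m _)    (unmerged ¬end₂) eq _    = ⊥-elim (¬end₂ k<m (inj₁ (sym (cong proj₁ eq))))
    views-merge (unmerged ¬end₁)  (merged k<m _)   eq _    = ⊥-elim (¬end₁ k<m (inj₁ (cong proj₁ eq)))
    views-merge (unmerged _)      (unmerged _)     eq u₁≢u₂ = ⊥-elim (u₁≢u₂ (cong proj₁ eq))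

  laterIndices : Fin (cliqueSize G) → List (Fin (cliqueSize G))
  laterIndices j = filterᵇ (λ j′ → ⌊ toℕ j <? toℕ j′ ⌋) (allFin (cliqueSize G))

  cliqueBlock : Fin (n G) → List (PreV G × PreV G)
  cliqueBlock u =
    concatMap (λ j → map (λ j′ → (canon G (u , j) , canon G (u , j′))) (laterIndices j)) (allFin (cliqueSize G))

  pairCount : ℕ
  pairCount = length (concatMap laterIndices (allFin (cliqueSize G)))

  length-cliqueBlock : ∀ u → length (cliqueBlock u) ≡ pairCount
  length-cliqueBlock u = length-concatMap-map _ laterIndices (allFin (cliqueSize G))

  cliqueBlock-∈ : ∀ {u x} → x ∈ cliqueBlock u → ∃₂ λ j j′ → x ≡ (canon G (u , j) , canon G (u , j′))
  cliqueBlock-∈ {u} x∈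
    with satisfied (∈-concatMap⁻ (λ j → map (λ j′ → (canon G (u , j) , canon G (u , j′))) (laterIndices j)) {xs = allFin (cliqueSize G)} x∈)
  ... | j , x∈′ with ∈-map⁻ (λ j′ → (canon G (u , j) , canon G (u , j′))) {xs = laterIndices j} x∈′
  ... | j′ , _ , x≡ = j , j′ , x≡

  taggedEdges : List (Fin (n G) × (PreV G × PreV G))
  taggedEdges = Tagged cliqueBlock (allFin (n G))

  -- cliqueEdges G is definitionally concatMap cliqueBlock (allFin (n G)).
  untag-taggedEdges : map proj₂ taggedEdges ≡ cliqueEdges G
  untag-taggedEdges = map-proj₂-Tagged cliqueBlock (allFin (n G))

  owner : Fin (numE (K G)) → Fin (n G)
  owner = tagAt taggedEdges untag-taggedEdges

  countF-owner : ∀ (P : Fin (n G) → Bool) → countF (numE (K G)) (P ∘ owner) ≡ countF (n G) P * pairCount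
  countF-owner P = begin
    countF (numE (K G)) (P ∘ owner)
      ≡⟨ countF-tagAt taggedEdges untag-taggedEdges P ⟩
    countL (P ∘ proj₁) taggedEdges
      ≡⟨ countL-Tagged P length-cliqueBlock (allFin (n G)) ⟩
    countL P (allFin (n G)) * pairCount
      ≡⟨ cong (_* pairCount) (countL-tabulate P (λ u → u)) ⟩
    countF (n G) P * pairCount ∎
    where open ≡-Reasoning

  numE-K : numE (K G) ≡ n G * pairCount
  numE-K = trans (sym (countF-true (numE (K G))))
                 (trans (countF-owner (λ _ → true)) (cong (_* pairCount) (countF-true (n G))))

  owner-preserves-balance : ∀ {p q} c → VBalanced p q G c → EBalanced p q (K G) (c ∘ owner)
  owner-preserves-balance {p} {q} c (bal₁ , bal₂) = scale c bal₁ , scale (not ∘ c) bal₂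
    where
    scale : ∀ P → BalancedSize p q (n G) (countF (n G) P) →
            BalancedSize p q (numE (K G)) (countF (numE (K G)) (P ∘ owner))
    scale P bal = subst₂ (BalancedSize p q) (sym numE-K) (sym (countF-owner P)) (BalancedSize-* {p} {q} pairCount bal)

  endpoint-cliqueBlock : ∀ {u x} v → x ∈ cliqueBlock u → v ≡ proj₁ x ⊎ v ≡ proj₂ x → canon G (u , proj₂ v) ≡ v
  endpoint-cliqueBlock v x∈ v∈x with cliqueBlock-∈ x∈
  endpoint-cliqueBlock v x∈ (inj₁ v≡x₁) | _ , _ , x≡ = canon-at-snd (trans v≡x₁ (cong proj₁ x≡))
  endpoint-cliqueBlock v x∈ (inj₂ v≡x₂) | _ , _ , x≡ = canon-at-snd (trans v≡x₂ (cong proj₂ x≡))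

  incident⇒canon : ∀ v e → T (incident (K G) v e) → canon G (owner e , proj₂ v) ≡ v
  incident⇒canon v e inc =
    endpoint-cliqueBlock v (∈-Tagged⁻ {blocks = cliqueBlock} {xs = allFin (n G)} (tagAt-∈ taggedEdges untag-taggedEdges e))
                           (incident⇒endpoint (K G) v e inc)

  count-allPre : ∀ (P : PreV G → Bool) →
    countL P (allPre G) ≡ ∑[ u < n G ] ∑[ k < cliqueSize G ] indicator (P (u , k))
  count-allPre P = trans
    (countL-concatMap-tabulate P (λ u → map (u ,_) (allFin (cliqueSize G))) (λ u → u))
    (sum-cong-≗ (λ u → trans (countL-map P (u ,_) (allFin (cliqueSize G)))
                 (trans (countL-tabulate (P ∘ (u ,_)) (λ k → k)) (countF≡∑ (cliqueSize G) (P ∘ (u ,_))))))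

  module _ (c : Fin (n G) → Bool) where

    isCutEdge : Fin (m G) → Bool
    isCutEdge i = xor (c (proj₁ (edge G i))) (c (proj₂ (edge G i)))

    isCutVertexᴷ : PreV G → Bool
    isCutVertexᴷ = isCutVertex (K G) (c ∘ owner)

    cut-between : ∀ {u₁ u₂ i} → Endpoint u₁ (edge G i) → Endpoint u₂ (edge G i) →
                  T (c u₁) → T (not (c u₂)) → T (isCutEdge i)
    cut-between (inj₁ refl) (inj₂ refl) c₁ c₂ = proj₁ (xor-true c₁ c₂)
    cut-between (inj₂ refl) (inj₁ refl) c₁ c₂ = proj₂ (xor-true c₁ c₂)
    cut-between (inj₁ refl) (inj₁ refl) c₁ c₂ = ⊥-elim (T-not-¬ c₁ c₂)
    cut-between (inj₂ refl) (inj₂ refl) c₁ c₂ = ⊥-elim (T-not-¬ c₁ c₂)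

    CutRepresentative : PreV G → Set
    CutRepresentative (u , k) =
      Σ (toℕ k < m G) λ k<m → u ≡ proj₁ (edge G (fromℕ< k<m)) × T (isCutEdge (fromℕ< k<m))

    isCutVertex⇒CutRepresentative : ∀ v → T (isCutVertexᴷ v) → CutRepresentative v
    isCutVertex⇒CutRepresentative v isCut =
      let e₁ , e₂ , inc₁ , c₁ , inc₂ , ¬c₂ = isCutVertex⇒witnesses (K G) (c ∘ owner) v isCut
          canon₁ = incident⇒canon v e₁ inc₁
          k<m , end₁ , end₂ , fst≡a = canon-merge (proj₂ v) (trans canon₁ (sym (incident⇒canon v e₂ inc₂)))
                                        (λ same → T-not-¬ c₁ (subst (T ∘ not ∘ c) (sym same) ¬c₂))
      in k<m , trans (sym (cong proj₁ canon₁)) fst≡a , cut-between end₁ end₂ c₁ ¬c₂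

    column : Fin (cliqueSize G) → ℕ
    column k = ∑[ u < n G ] indicator (isCutVertexᴷ (u , k))

    column≡0 : ∀ k → ¬ toℕ k < m G → column k ≡ 0
    column≡0 k k≮m = n≤0⇒n≡0 (≤-trans
      (∑-mono-≤ (λ u → indicator-mono (λ isCut → k≮m (proj₁ (isCutVertex⇒CutRepresentative (u , k) isCut)))))
      (≤-reflexive (sum-replicate-zero (n G))))

    -- Only the representative (a_k , k) of a cut edge e_k can be a cut vertex in column k.
    column≤ : ∀ k (k<m : toℕ k < m G) → column k ≤ indicator (isCutEdge (fromℕ< k<m))
    column≤ k k<m = ≤-trans
      (∑-mono-≤ (λ u → indicator-mono (λ isCut →
        let _ , u≡a , cut = isCutVertex⇒CutRepresentative (u , k) isCut in T-∧ .from (cut , fromWitness u≡a))))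
      (≤-reflexive (∑-indicator-∧-≟ (isCutEdge (fromℕ< k<m)) (proj₁ (edge G (fromℕ< k<m)))))

    cutVertices≤edgeCut : cutVertices (K G) (c ∘ owner) ≤ edgeCut G c
    cutVertices≤edgeCut = begin
      cutVertices (K G) (c ∘ owner)
        ≤⟨ countL-filterᵇ-≤ isCutVertexᴷ (λ x → ⌊ decPreV G (canon G x) x ⌋) (allPre G) ⟩
      countL isCutVertexᴷ (allPre G)
        ≡⟨ count-allPre isCutVertexᴷ ⟩
      ∑[ u < n G ] ∑[ k < cliqueSize G ] indicator (isCutVertexᴷ (u , k))
        ≡⟨ ∑-comm (λ u k → indicator (isCutVertexᴷ (u , k))) ⟩
      ∑[ k < cliqueSize G ] column k
        ≤⟨ ∑-≤-countF column isCutEdge column≡0 column≤ ⟩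
      edgeCut G c ∎
      where open ≤-Reasoning

mainTheorem3 : (p q : ℕ) → 0 < q → p < q → (G : Graph) →
               q ∣ p * n G → 2 * q ∣ (q + p) * n G →
               (a b : ℕ) → IsGEB p q (K G) a → IsGB p q G b → a ≤ b
mainTheorem3 p q _ _ G _ _ a b (_ , minimal) ((c , balanced , refl) , _) =
  ≤-trans (minimal (c ∘ owner) (owner-preserves-balance {p} {q} c balanced)) (cutVertices≤edgeCut c)
  where open CliqueExpansion G
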